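{- Let $w$ be a double occurrence word in ascending order, let $\nu\ge 2$, and let $\mathcal{I}_1(\nu,k_1,\ell_1)$ and $\mathcal{I}_2(\nu,k_2,\ell_2)$ be two insertions into $w$ with $(k_1,\ell_1)\ne(k_2,\ell_2)$. If $w\star\mathcal{I}_1(\nu,k_1,\ell_1)\sim w\star\mathcal{I}_2(\nu,k_2,\ell_2)$, then either both $\mathcal{I}_1,\mathcal{I}_2$ are repeat insertions or both are return insertions.
   Context: Alphabet $\Sigma=\mathbb{N}$; words are finite sequences over $\Sigma$, $|w|$ is length, $w^R$ the reverse. A double occurrence word (DOW) is a word in which every symbol occurs either zero or exactly two times. An equivalence map is a morphism of $\Sigma^*$ induced by a bijection $\Sigma\to\Sigma$; $x\sim y$ means $f(x)=y$ for some equivalence map $f$. A word is in ascending order if it is empty or its first symbol is $1$ and the first occurrence of each symbol is one greater than the largest symbol preceding it. Insertions: let $w$ be a DOW in ascending order, $M$ its largest symbol ($M=0$ if $w$ is empty), $\nu\ge1$, and $u=(M+1)(M+2)\cdots(M+\nu)$. For integers $1\le k\le\ell\le|w|+1$ write $w=y_1y_2y_3$ with $|y_1|=k-1$, $|y_1y_2|=\ell-1$. The repeat insertion gives $w\star\rho(\nu,k,\ell)=y_1uy_2uy_3$ and the return insertion gives $w\star\tau(\nu,k,\ell)=y_1uy_2u^Ry_3$. $\mathcal{I}(\nu,k,\ell)$ denotes an insertion of either kind. -}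

module Defs where

open import Data.Nat using (ℕ; zero; suc; _+_; _∸_; _⊔_; _≤_)
open import Data.Nat.Properties using (_≟_)
open import Data.List using (List; []; _∷_; _++_; length; map; take; drop; reverse; foldr)
open import Data.List.Membership.Propositional using (_∈_)
open import Data.List.Relation.Unary.All using (All)
open import Data.Product using (Σ; _×_)
open import Function.Bundles using (Bijection; _⤖_)
open import Relation.Binary.PropositionalEquality using (_≡_)
open import Relation.Nullary.Decidable using (⌊_⌋)
open import Data.Sum using (_⊎_)
open import Relation.Nullary using (¬_; yes; no)

Word : Set
Word = List ℕ

occ : ℕ → Word → ℕ
occ a [] = 0
occ a (b ∷ w) with a ≟ b
... | yes _ = suc (occ a w)
... | no  _ = occ a w

DOW : Word → Set
DOW w = ∀ (a : ℕ) → (occ a w ≡ 0) ⊎ (occ a w ≡ 2)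

maxSym : Word → ℕ
maxSym = foldr _⊔_ 0

-- ascending order: reading left to right with current maximum m
-- (initially 0), each symbol is either a repeat of an earlier symbol,
-- or a first occurrence, in which case it equals m + 1.
data AscFrom : Word → Word → Set where
  asc-[]  : ∀ {seen} → AscFrom seen []
  asc-old : ∀ {seen a w} → a ∈ seen → AscFrom (a ∷ seen) w → AscFrom seen (a ∷ w)
  asc-new : ∀ {seen a w} → ¬ (a ∈ seen) → a ≡ suc (maxSym seen) →
            AscFrom (a ∷ seen) w → AscFrom seen (a ∷ w)

Ascending : Word → Set
Ascending w = AscFrom [] w

-- u = (M+1)(M+2)...(M+ν)
block : ℕ → ℕ → Word
block M zero = []
block M (suc ν) = block M ν ++ (suc (M + ν) ∷ [])

data Kind : Set where
  repeatIns returnIns : Kind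

-- w ⋆ I(ν,k,ℓ):  w = y1 y2 y3 with |y1| = k-1, |y1 y2| = ℓ-1
insert : Kind → Word → ℕ → ℕ → ℕ → Word
insert κ w ν k ℓ =
  y1 ++ u ++ y2 ++ second κ ++ y3
  where
    u  = block (maxSym w) ν
    y1 = take (k ∸ 1) w
    y2 = take ((ℓ ∸ 1) ∸ (k ∸ 1)) (drop (k ∸ 1) w)
    y3 = drop (ℓ ∸ 1) w
    second : Kind → Word
    second repeatIns = u
    second returnIns = reverse u

_∼_ : Word → Word → Set
x ∼ y = Σ (ℕ ⤖ ℕ) (λ f → map (Bijection.to f) x ≡ y)

ValidPos : Word → ℕ → ℕ → Set
ValidPos w k ℓ = (1 ≤ k) × (k ≤ ℓ) × (ℓ ≤ suc (length w))

-- For a symbol a of a word W let enclosed a W be the number of positions strictly between the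
-- first two occurrences of a whose symbol occurs exactly twice there. For every modulus m and
-- residue ρ, the number of positions of W whose symbol a has enclosed a W ≡ ρ (mod m) is invariant
-- under relabelling. Take m = 2ν, where ν = |u| is the length of the inserted block. Inserting u
-- and a second copy of u or uᴿ changes enclosed of an old symbol by 0 or by 2ν, so the old positions
-- contribute the same amount to both words. In a repeat insertion y₁ u y₂ u y₃ every new symbol
-- encloses exactly the doubles of y₂, so all 2ν new positions share one residue. In a return
-- insertion z₁ u z₂ uᴿ z₃ the symbol of u followed by j further letters of u encloses the doubles of
-- z₂ plus 2j; these residues are pairwise distinct modulo 2ν, so every residue is taken by at most
-- 2 new positions. As ν ≥ 2, the two words cannot be equivalent.

module Submission where

open import Defs
open import Data.Bool using (Bool; true; false; if_then_else_)
open import Data.Empty using (⊥-elim)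
open import Data.List using ([]; _∷_; _++_; length; map; reverse; filter; take; drop; [_])
open import Data.List.Properties
  using (unfold-reverse; ++-identityʳ; length-++; length-reverse; take++drop≡id; drop-drop;
         filter-++; filter-accept; filter-reject; filter-all; filter-none)
open import Data.List.Membership.Propositional using (_∈_)
open import Data.List.Relation.Unary.Any using (here; there)
import Data.List.Relation.Unary.Any.Properties as Any
open import Data.List.Relation.Unary.All as All using (All; []; _∷_)
open import Data.List.Relation.Unary.All.Properties using (++⁺; take⁺; drop⁺; all-filter)
open import Data.Nat
  using (ℕ; zero; suc; _+_; _∸_; _*_; _≤_; _<_; z≤n; s≤s; s≤s⁻¹; z<s; NonZero; >-nonZero)
open import Data.Nat.Properties
open import Data.Nat.DivMod using (_%_; _/_; m≡m%n+[m/n]*n; [m+n]%n≡m%n)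
open import Data.Nat.Divisibility using (_∣_; divides; ∣m+n∣m⇒∣n; n∣m*n; >⇒∤)
open import Data.Nat.Solver using (module +-*-Solver)
open import Data.Product using (_×_; _,_)
open import Data.Sum using (_⊎_; inj₁; inj₂)
open import Function using (_∘_)
open import Function.Bundles using (Bijection)
open import Function.Definitions using (Injective)
open import Level using (Level)
open import Relation.Binary.Definitions using (tri<; tri≈; tri>)
open import Relation.Binary.PropositionalEquality hiding ([_])
open import Relation.Nullary using (¬_; Dec; yes; no; does; contradiction)
open import Relation.Nullary.Decidable using (dec-true; dec-false)
open import Relation.Unary using (Pred; Decidable)
open import Relation.Unary.Properties using (∁?)

private
  variable
    ℓ : Level
    P : Pred ℕ ℓ

occ-here : ∀ a X → occ a (a ∷ X) ≡ suc (occ a X)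
occ-here a X with a ≟ a
... | yes _ = refl
... | no a≢a = contradiction refl a≢a

occ-there : ∀ {a b} X → a ≢ b → occ a (b ∷ X) ≡ occ a X
occ-there {a} {b} X a≢b with a ≟ b
... | yes a≡b = contradiction a≡b a≢b
... | no _ = refl

occ-++ : ∀ a X Y → occ a (X ++ Y) ≡ occ a X + occ a Y
occ-++ a [] Y = refl
occ-++ a (b ∷ X) Y with a ≟ b
... | yes _ = cong suc (occ-++ a X Y)
... | no _ = occ-++ a X Y

occ-reverse : ∀ a X → occ a (reverse X) ≡ occ a X
occ-reverse a [] = refl
occ-reverse a (b ∷ X) rewrite unfold-reverse b X | occ-++ a (reverse X) [ b ] | occ-reverse a X
  with a ≟ b
... | yes _ = +-comm (occ a X) 1
... | no _ = +-identityʳ (occ a X)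

occ-≤-occ-∷ : ∀ a b X → occ a X ≤ occ a (b ∷ X)
occ-≤-occ-∷ a b X with a ≟ b
... | yes _ = n≤1+n _
... | no _ = ≤-refl

∈⇒occ-pos : ∀ {a X} → a ∈ X → 0 < occ a X
∈⇒occ-pos {a} {b ∷ X} (here refl) rewrite occ-here a X = s≤s z≤n
∈⇒occ-pos {a} {b ∷ X} (there a∈X) with a ≟ b
... | yes _ = s≤s z≤n
... | no _ = ∈⇒occ-pos a∈X

occ-∉ : ∀ {a X} → All P X → ¬ P a → occ a X ≡ 0
occ-∉ [] ¬Pa = refl
occ-∉ {a = a} (_∷_ {x = b} Pb PX) ¬Pa with a ≟ b
... | yes refl = contradiction Pb ¬Pa
... | no _ = occ-∉ PX ¬Pa

All-reverse : ∀ {X} → All P X → All P (reverse X)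
All-reverse PX = All.tabulate (λ y∈ → All.lookup PX (Any.reverse⁻ y∈))

NoRepeats : Word → Set
NoRepeats X = ∀ y → occ y X ≤ 1

occ-≡1 : ∀ {y} X → NoRepeats X → 0 < occ y X → occ y X ≡ 1
occ-≡1 {y} X noRep pos = ≤-antisym (noRep y) pos

-- The factor between the first two occurrences of a symbol

after : ℕ → Word → Word
after a [] = []
after a (b ∷ X) with a ≟ b
... | yes _ = X
... | no _ = after a X

before : ℕ → Word → Word
before a [] = []
before a (b ∷ X) with a ≟ b
... | yes _ = []
... | no _ = b ∷ before a X

between : ℕ → Word → Word
between a X = before a (after a X)

after-here : ∀ a X → after a (a ∷ X) ≡ X
after-here a X with a ≟ a
... | yes _ = refl
... | no a≢a = contradiction refl a≢a

after-there : ∀ {a b} X → a ≢ b → after a (b ∷ X) ≡ after a X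
after-there {a} {b} X a≢b with a ≟ b
... | yes a≡b = contradiction a≡b a≢b
... | no _ = refl

before-here : ∀ a X → before a (a ∷ X) ≡ []
before-here a X with a ≟ a
... | yes _ = refl
... | no a≢a = contradiction refl a≢a

before-there : ∀ {a b} X → a ≢ b → before a (b ∷ X) ≡ b ∷ before a X
before-there {a} {b} X a≢b with a ≟ b
... | yes a≡b = contradiction a≡b a≢b
... | no _ = refl

after-++-absent : ∀ a X Y → occ a X ≡ 0 → after a (X ++ Y) ≡ after a Y
after-++-absent a [] Y _ = refl
after-++-absent a (b ∷ X) Y h with a ≟ b
... | no _ = after-++-absent a X Y h

after-++-present : ∀ a X Y → 0 < occ a X → after a (X ++ Y) ≡ after a X ++ Y
after-++-present a (b ∷ X) Y h with a ≟ b
... | yes _ = refl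
... | no _ = after-++-present a X Y h

before-++-absent : ∀ a X Y → occ a X ≡ 0 → before a (X ++ Y) ≡ X ++ before a Y
before-++-absent a [] Y _ = refl
before-++-absent a (b ∷ X) Y h with a ≟ b
... | no _ = cong (b ∷_) (before-++-absent a X Y h)

before-++-present : ∀ a X Y → 0 < occ a X → before a (X ++ Y) ≡ before a X
before-++-present a (b ∷ X) Y h with a ≟ b
... | yes _ = refl
... | no _ = cong (b ∷_) (before-++-present a X Y h)

occ-after : ∀ a X → 0 < occ a X → occ a X ≡ suc (occ a (after a X))
occ-after a (b ∷ X) h with a ≟ b
... | yes _ = refl
... | no _ = occ-after a X h

occ-before+occ-after≤occ : ∀ z a X → occ z (before a X) + occ z (after a X) ≤ occ z X
occ-before+occ-after≤occ z a [] = z≤n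
occ-before+occ-after≤occ z a (b ∷ X) with a ≟ b
... | yes _ = occ-≤-occ-∷ z b X
... | no _ with z ≟ b
... | yes _ = s≤s (occ-before+occ-after≤occ z a X)
... | no _ = occ-before+occ-after≤occ z a X

occ-after≤occ : ∀ z a X → occ z (after a X) ≤ occ z X
occ-after≤occ z a X = ≤-trans (m≤n+m _ _) (occ-before+occ-after≤occ z a X)

All-after : ∀ a {X} → All P X → All P (after a X)
All-after a [] = []
All-after a (_∷_ {x = b} Pb PX) with a ≟ b
... | yes _ = PX
... | no _ = All-after a PX

All-before : ∀ a {X} → All P X → All P (before a X)
All-before a [] = []
All-before a (_∷_ {x = b} Pb PX) with a ≟ b
... | yes _ = []
... | no _ = Pb ∷ All-before a PX

All-between : ∀ a {X} → All P X → All P (between a X)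
All-between a PX = All-before a (All-after a PX)

between-++-absent : ∀ a X Y → occ a X ≡ 0 → between a (X ++ Y) ≡ between a Y
between-++-absent a X Y h = cong (before a) (after-++-absent a X Y h)

between-++-once : ∀ a X Y → occ a X ≡ 1 → between a (X ++ Y) ≡ after a X ++ before a Y
between-++-once a X Y h = begin
  before a (after a (X ++ Y)) ≡⟨ cong (before a) (after-++-present a X Y (≤-reflexive (sym h))) ⟩
  before a (after a X ++ Y)   ≡⟨ before-++-absent a (after a X) Y absent ⟩
  after a X ++ before a Y     ∎
  where
  open ≡-Reasoning
  absent : occ a (after a X) ≡ 0
  absent = suc-injective (trans (sym (occ-after a X (≤-reflexive (sym h)))) h)

between-++-twice : ∀ a X Y → 2 ≤ occ a X → between a (X ++ Y) ≡ between a X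
between-++-twice a X Y h = begin
  before a (after a (X ++ Y)) ≡⟨ cong (before a) (after-++-present a X Y present) ⟩
  before a (after a X ++ Y)   ≡⟨ before-++-present a (after a X) Y again ⟩
  before a (after a X)        ∎
  where
  open ≡-Reasoning
  present : 0 < occ a X
  present = ≤-trans (s≤s z≤n) h
  again : 0 < occ a (after a X)
  again = s≤s⁻¹ (≤-trans h (≤-reflexive (occ-after a X present)))

before-reverse : ∀ a X → occ a X ≡ 1 → before a (reverse X) ≡ reverse (after a X)
before-reverse a (b ∷ X) h rewrite unfold-reverse b X with a ≟ b
... | yes refl = begin
  before a (reverse X ++ [ a ]) ≡⟨ before-++-absent a (reverse X) [ a ] a∉X ⟩
  reverse X ++ before a [ a ]   ≡⟨ cong (reverse X ++_) (before-here a []) ⟩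
  reverse X ++ []               ≡⟨ ++-identityʳ (reverse X) ⟩
  reverse X                     ∎
  where
  open ≡-Reasoning
  a∉X : occ a (reverse X) ≡ 0
  a∉X = trans (occ-reverse a X) (suc-injective h)
... | no _ = trans (before-++-present a (reverse X) [ b ] (≤-reflexive (sym (trans (occ-reverse a X) h))))
                   (before-reverse a X h)

length-after< : ∀ a X → 0 < occ a X → length (after a X) < length X
length-after< a (b ∷ X) h with a ≟ b
... | yes _ = ≤-refl
... | no _ = m<n⇒m<1+n (length-after< a X h)

length-after-injective : ∀ {a a'} X → 0 < occ a X → 0 < occ a' X →
                         length (after a X) ≡ length (after a' X) → a ≡ a'
length-after-injective {a} {a'} (b ∷ X) a∈ a'∈ eq with a ≟ b | a' ≟ b
... | yes a≡b | yes a'≡b = trans a≡b (sym a'≡b)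
... | yes _   | no _     = contradiction (sym eq) (<⇒≢ (length-after< a' X a'∈))
... | no _    | yes _    = contradiction eq (<⇒≢ (length-after< a X a∈))
... | no _    | no _     = length-after-injective X a∈ a'∈ eq

module _ {P : Pred ℕ ℓ} (P? : Decidable P) where

  filter-after : ∀ {a} X → P a → filter P? (after a X) ≡ after a (filter P? X)
  filter-after [] _ = refl
  filter-after {a} (b ∷ X) Pa with P? b | a ≟ b
  ... | yes _  | yes refl = sym (after-here a (filter P? X))
  ... | yes _  | no a≢b   = trans (filter-after X Pa) (sym (after-there (filter P? X) a≢b))
  ... | no ¬Pb | yes refl = contradiction Pa ¬Pb
  ... | no _   | no _     = filter-after X Pa

  filter-before : ∀ {a} X → P a → filter P? (before a X) ≡ before a (filter P? X)
  filter-before [] _ = refl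
  filter-before {a} (b ∷ X) Pa with P? b | a ≟ b
  ... | yes _  | yes refl = sym (before-here a (filter P? X))
  ... | yes Pb | no a≢b   = begin
    filter P? (b ∷ before a X)   ≡⟨ filter-accept P? Pb ⟩
    b ∷ filter P? (before a X)   ≡⟨ cong (b ∷_) (filter-before X Pa) ⟩
    b ∷ before a (filter P? X)   ≡⟨ before-there (filter P? X) a≢b ⟨
    before a (b ∷ filter P? X)   ∎
    where open ≡-Reasoning
  ... | no ¬Pb | yes refl = contradiction Pa ¬Pb
  ... | no ¬Pb | no _     = trans (filter-reject P? ¬Pb) (filter-before X Pa)

  filter-between : ∀ {a} X → P a → filter P? (between a X) ≡ between a (filter P? X)
  filter-between {a} X Pa = trans (filter-before (after a X) Pa) (cong (before a) (filter-after X Pa))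

-- Counting doubles and residues

count : (ℕ → Bool) → Word → ℕ
count p [] = 0
count p (x ∷ X) = if p x then suc (count p X) else count p X

count-++ : ∀ p X Y → count p (X ++ Y) ≡ count p X + count p Y
count-++ p [] Y = refl
count-++ p (x ∷ X) Y with p x
... | true = cong suc (count-++ p X Y)
... | false = count-++ p X Y

count-reverse : ∀ p X → count p (reverse X) ≡ count p X
count-reverse p [] = refl
count-reverse p (x ∷ X) rewrite unfold-reverse x X | count-++ p (reverse X) [ x ] | count-reverse p X
  with p x
... | true = +-comm (count p X) 1
... | false = +-identityʳ (count p X)

count-map : ∀ p f X → count p (map f X) ≡ count (λ x → p (f x)) X
count-map p f [] = refl
count-map p f (x ∷ X) with p (f x)
... | true = cong suc (count-map p f X)
... | false = count-map p f X

count-cong : ∀ {p q X} → All (λ y → p y ≡ q y) X → count p X ≡ count q X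
count-cong [] = refl
count-cong {p} {q} (_∷_ {x = x} px≡qx eqs) rewrite px≡qx with q x
... | true = cong suc (count-cong eqs)
... | false = count-cong eqs

count-all : ∀ {p X} → All (λ y → p y ≡ true) X → count p X ≡ length X
count-all [] = refl
count-all (px ∷ pX) rewrite px = cong suc (count-all pX)

count-none : ∀ {p X} → All (λ y → p y ≡ false) X → count p X ≡ 0
count-none [] = refl
count-none (px ∷ pX) rewrite px = count-none pX

count-partition : ∀ p {Q : Pred ℕ ℓ} (Q? : Decidable Q) X →
                  count p X ≡ count p (filter Q? X) + count p (filter (∁? Q?) X)
count-partition p Q? [] = refl
count-partition p Q? (x ∷ X) with Q? x
... | yes _ with p x
...   | true  = cong suc (count-partition p Q? X)
...   | false = count-partition p Q? X
count-partition p Q? (x ∷ X) | no _ with p x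
...   | true  = trans (cong suc (count-partition p Q? X)) (sym (+-suc _ _))
...   | false = count-partition p Q? X

count-≤1 : ∀ p X → NoRepeats X →
           (∀ {y y'} → y ∈ X → y' ∈ X → p y ≡ true → p y' ≡ true → y ≡ y') →
           count p X ≤ 1
count-≤1 p [] _ _ = z≤n
count-≤1 p (x ∷ X) noRep unique with p x in px
... | true = s≤s (≤-reflexive (count-none (All.tabulate rest-false)))
  where
  rest-false : ∀ {y} → y ∈ X → p y ≡ false
  rest-false {y} y∈X with p y in py
  ... | false = refl
  ... | true with unique (there y∈X) (here refl) py px
  ... | refl = contradiction (noRep x) (<⇒≱ (begin-strict
        1                ≤⟨ ∈⇒occ-pos y∈X ⟩
        occ x X          <⟨ n<1+n _ ⟩
        suc (occ x X)    ≡⟨ occ-here x X ⟨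
        occ x (x ∷ X)    ∎))
    where open ≤-Reasoning
... | false = count-≤1 p X (λ y → ≤-trans (occ-≤-occ-∷ y x X) (noRep y))
                           (λ y∈ y'∈ → unique (there y∈) (there y'∈))

occ-partition : ∀ a {Q : Pred ℕ ℓ} (Q? : Decidable Q) X →
                occ a X ≡ occ a (filter Q? X) + occ a (filter (∁? Q?) X)
occ-partition a Q? [] = refl
occ-partition a Q? (x ∷ X) with Q? x
... | yes _ with a ≟ x
...   | yes _ = cong suc (occ-partition a Q? X)
...   | no _  = occ-partition a Q? X
occ-partition a Q? (x ∷ X) | no _ with a ≟ x
...   | yes _ = trans (cong suc (occ-partition a Q? X)) (sym (+-suc _ _))
...   | no _  = occ-partition a Q? X

twiceIn : Word → ℕ → Bool
twiceIn S y = does (occ y S ≟ 2)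

doubles : Word → ℕ
doubles S = count (twiceIn S) S

doubles-partition : ∀ {Q : Pred ℕ ℓ} (Q? : Decidable Q) S →
                    doubles S ≡ doubles (filter Q? S) + doubles (filter (∁? Q?) S)
doubles-partition {Q = Q} Q? S = trans (count-partition (twiceIn S) Q? S)
  (cong₂ _+_ (count-cong (All.map (cong (λ n → does (n ≟ 2)) ∘ occ-accepted) (all-filter Q? S)))
             (count-cong (All.map (cong (λ n → does (n ≟ 2)) ∘ occ-rejected) (all-filter (∁? Q?) S))))
  where
  open ≡-Reasoning
  occ-accepted : ∀ {y} → Q y → occ y S ≡ occ y (filter Q? S)
  occ-accepted {y} Qy = begin
    occ y S                                            ≡⟨ occ-partition y Q? S ⟩
    occ y (filter Q? S) + occ y (filter (∁? Q?) S)     ≡⟨ cong (occ y (filter Q? S) +_) absent ⟩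
    occ y (filter Q? S) + 0                            ≡⟨ +-identityʳ _ ⟩
    occ y (filter Q? S)                                ∎
    where
    absent : occ y (filter (∁? Q?) S) ≡ 0
    absent = occ-∉ (all-filter (∁? Q?) S) (λ ¬Qy → ¬Qy Qy)
  occ-rejected : ∀ {y} → ¬ Q y → occ y S ≡ occ y (filter (∁? Q?) S)
  occ-rejected {y} ¬Qy =
    trans (occ-partition y Q? S) (cong (_+ occ y (filter (∁? Q?) S)) (occ-∉ (all-filter Q? S) ¬Qy))

doubles-≡0 : ∀ S → NoRepeats S → doubles S ≡ 0
doubles-≡0 S noRep = count-none (All.universal not-twice S)
  where
  not-twice : ∀ y → twiceIn S y ≡ false
  not-twice y = dec-false (occ y S ≟ 2) (λ eq → 1+n≰n (subst (_≤ 1) eq (noRep y)))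

doubles-≡length : ∀ S → All (λ y → occ y S ≡ 2) S → doubles S ≡ length S
doubles-≡length S twice = count-all (All.map (λ eq → dec-true (_ ≟ 2) eq) twice)

doubles-++-copy : ∀ N N' → NoRepeats N → (∀ y → occ y N' ≡ occ y N) →
                  doubles (N ++ N') ≡ length (N ++ N')
doubles-++-copy N N' noRep same =
  doubles-≡length (N ++ N') (++⁺ (All.tabulate (twice ∘ ∈⇒occ-pos)) (All.tabulate (twice ∘ copied)))
  where
  copied : ∀ {y} → y ∈ N' → 0 < occ y N
  copied {y} y∈N' = subst (0 <_) (same y) (∈⇒occ-pos y∈N')
  twice : ∀ {y} → 0 < occ y N → occ y (N ++ N') ≡ 2
  twice {y} pos = begin
    occ y (N ++ N')        ≡⟨ occ-++ y N N' ⟩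
    occ y N + occ y N'     ≡⟨ cong (occ y N +_) (same y) ⟩
    occ y N + occ y N      ≡⟨ cong (λ n → n + n) (occ-≡1 N noRep pos) ⟩
    2                      ∎
    where open ≡-Reasoning

enclosed : ℕ → Word → ℕ
enclosed a W = doubles (between a W)

does-true⇒ : ∀ {a} {A : Set a} (A? : Dec A) → does A? ≡ true → A
does-true⇒ (yes a) _ = a

hasResidue : (m : ℕ) .{{_ : NonZero m}} → ℕ → Word → ℕ → Bool
hasResidue m ρ W a = does (enclosed a W % m ≟ ρ)

residueCount : (m : ℕ) .{{_ : NonZero m}} → ℕ → Word → ℕ
residueCount m ρ W = count (hasResidue m ρ W) W

-- Invariance under relabelling

module Relabelling (f : ℕ → ℕ) (f-injective : Injective _≡_ _≡_ f) where

  occ-map : ∀ a X → occ (f a) (map f X) ≡ occ a X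
  occ-map a [] = refl
  occ-map a (b ∷ X) with a ≟ b
  ... | yes refl = trans (occ-here (f a) (map f X)) (cong suc (occ-map a X))
  ... | no a≢b = trans (occ-there (map f X) (a≢b ∘ f-injective)) (occ-map a X)

  after-map : ∀ a X → after (f a) (map f X) ≡ map f (after a X)
  after-map a [] = refl
  after-map a (b ∷ X) with a ≟ b
  ... | yes refl = after-here (f a) (map f X)
  ... | no a≢b = trans (after-there (map f X) (a≢b ∘ f-injective)) (after-map a X)

  before-map : ∀ a X → before (f a) (map f X) ≡ map f (before a X)
  before-map a [] = refl
  before-map a (b ∷ X) with a ≟ b
  ... | yes refl = before-here (f a) (map f X)
  ... | no a≢b = trans (before-there (map f X) (a≢b ∘ f-injective)) (cong (f b ∷_) (before-map a X))

  between-map : ∀ a X → between (f a) (map f X) ≡ map f (between a X)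
  between-map a X = trans (cong (before (f a)) (after-map a X)) (before-map a (after a X))

  doubles-map : ∀ S → doubles (map f S) ≡ doubles S
  doubles-map S = trans (count-map _ f S)
    (count-cong (All.universal (λ y → cong (λ n → does (n ≟ 2)) (occ-map y S)) S))

  enclosed-map : ∀ a W → enclosed (f a) (map f W) ≡ enclosed a W
  enclosed-map a W = trans (cong doubles (between-map a W)) (doubles-map (between a W))

  residueCount-map : ∀ m .{{_ : NonZero m}} ρ W → residueCount m ρ (map f W) ≡ residueCount m ρ W
  residueCount-map m ρ W = trans (count-map _ f W)
    (count-cong (All.universal (λ y → cong (λ n → does (n % m ≟ ρ)) (enclosed-map y W)) W))

%-offset⇒∣ : ∀ x d m .{{_ : NonZero m}} → (x + d) % m ≡ x % m → m ∣ d
%-offset⇒∣ x d m eq = ∣m+n∣m⇒∣n (divides ((x + d) / m) quotients) (n∣m*n (x / m))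
  where
  open ≡-Reasoning
  quotients : (x / m) * m + d ≡ ((x + d) / m) * m
  quotients = +-cancelˡ-≡ (x % m) _ _ (begin
    x % m + ((x / m) * m + d)         ≡⟨ +-assoc (x % m) _ d ⟨
    x % m + (x / m) * m + d           ≡⟨ cong (_+ d) (m≡m%n+[m/n]*n x m) ⟨
    x + d                             ≡⟨ m≡m%n+[m/n]*n (x + d) m ⟩
    (x + d) % m + ((x + d) / m) * m   ≡⟨ cong (_+ ((x + d) / m) * m) eq ⟩
    x % m + ((x + d) / m) * m         ∎)

double-offsets-%-distinct : ∀ {L} c {a b} m .{{_ : NonZero m}} → m ≡ L + L → a < b → b < L →
                            (c + (b + b)) % m ≢ (c + (a + a)) % m
double-offsets-%-distinct {L} c {a} {b} m m≡2L a<b b<L eq =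
  >⇒∤ {{>-nonZero 0<2s}} 2s<m (%-offset⇒∣ (c + (a + a)) (s + s) m (trans (cong (_% m) regroup) eq))
  where
  open +-*-Solver
  s : ℕ
  s = b ∸ a
  0<2s : 0 < s + s
  0<2s = ≤-trans (m<n⇒0<n∸m a<b) (m≤m+n s s)
  2s<m : s + s < m
  2s<m = subst (s + s <_) (sym m≡2L) (+-mono-< s<L s<L)
    where
    s<L : s < L
    s<L = ≤-<-trans (m∸n≤m b a) b<L
  regroup : c + (a + a) + (s + s) ≡ c + (b + b)
  regroup = trans (solve 3 (λ c a s → c :+ (a :+ a) :+ (s :+ s) := c :+ ((a :+ s) :+ (a :+ s))) refl c a s)
                  (cong (λ t → c + (t + t)) (m+[n∸m]≡n (<⇒≤ a<b)))

double-offset-%-injective : ∀ {L} c {a b} m .{{_ : NonZero m}} → m ≡ L + L → a < L → b < L →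
                            (c + (a + a)) % m ≡ (c + (b + b)) % m → a ≡ b
double-offset-%-injective c {a} {b} m m≡2L a<L b<L eq with <-cmp a b
... | tri< a<b _ _ = contradiction (sym eq) (double-offsets-%-distinct c m m≡2L a<b b<L)
... | tri≈ _ a≡b _ = a≡b
... | tri> _ _ b<a = contradiction eq (double-offsets-%-distinct c m m≡2L b<a a<L)

-- Inserting blocks of new symbols

module NewSymbols (M : ℕ) where

  Old New : Word → Set
  Old = All (_≤ M)
  New = All (M <_)

  newPart oldPart : Word → Word
  newPart = filter (M <?_)
  oldPart = filter (∁? (M <?_))

  newPart-new : ∀ {X} → New X → newPart X ≡ X
  newPart-new = filter-all (M <?_)

  newPart-old : ∀ {X} → Old X → newPart X ≡ []
  newPart-old = filter-none (M <?_) ∘ All.map ≤⇒≯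

  oldPart-new : ∀ {X} → New X → oldPart X ≡ []
  oldPart-new = filter-none (∁? (M <?_)) ∘ All.map (λ M<y ¬M<y → ¬M<y M<y)

  oldPart-old : ∀ {X} → Old X → oldPart X ≡ X
  oldPart-old = filter-all (∁? (M <?_)) ∘ All.map ≤⇒≯

  occ-old-in-new : ∀ {y X} → y ≤ M → New X → occ y X ≡ 0
  occ-old-in-new y≤M nX = occ-∉ nX (≤⇒≯ y≤M)

  occ-new-in-old : ∀ {y X} → M < y → Old X → occ y X ≡ 0
  occ-new-in-old M<y oX = occ-∉ oX (<⇒≱ M<y)

  newPart-new-++ : ∀ {N} → New N → ∀ Z → newPart (N ++ Z) ≡ N ++ newPart Z
  newPart-new-++ {N} nN Z = trans (filter-++ (M <?_) N Z) (cong (_++ newPart Z) (newPart-new nN))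

  newPart-old-++ : ∀ {X} → Old X → ∀ Z → newPart (X ++ Z) ≡ newPart Z
  newPart-old-++ {X} oX Z = trans (filter-++ (M <?_) X Z) (cong (_++ newPart Z) (newPart-old oX))

  oldPart-new-++ : ∀ {N} → New N → ∀ Z → oldPart (N ++ Z) ≡ oldPart Z
  oldPart-new-++ {N} nN Z = trans (filter-++ (∁? (M <?_)) N Z) (cong (_++ oldPart Z) (oldPart-new nN))

  oldPart-old-++ : ∀ {X} → Old X → ∀ Z → oldPart (X ++ Z) ≡ X ++ oldPart Z
  oldPart-old-++ {X} oX Z = trans (filter-++ (∁? (M <?_)) X Z) (cong (_++ oldPart Z) (oldPart-old oX))

  newPart-old-new : ∀ {X N} → Old X → New N → ∀ Z → newPart (X ++ N ++ Z) ≡ N ++ newPart Z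
  newPart-old-new oX nN Z = trans (newPart-old-++ oX _) (newPart-new-++ nN Z)

  oldPart-old-new : ∀ {X N} → Old X → New N → ∀ Z → oldPart (X ++ N ++ Z) ≡ X ++ oldPart Z
  oldPart-old-new {X} oX nN Z = trans (oldPart-old-++ oX _) (cong (X ++_) (oldPart-new-++ nN Z))

  newPart-before-block : ∀ {a X N} → a ≤ M → Old X → New N → ∀ R →
    (newPart (before a (X ++ N ++ R)) ≡ []) ⊎ (newPart (before a (X ++ N ++ R)) ≡ N ++ newPart (before a R))
  newPart-before-block {a} {X} {N} a≤M oX nN R with occ a X in e
  ... | zero = inj₂ (trans (cong newPart before≡) (newPart-old-new oX nN (before a R)))
    where
    before≡ : before a (X ++ N ++ R) ≡ X ++ N ++ before a R
    before≡ = trans (before-++-absent a X (N ++ R) e)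
                    (cong (X ++_) (before-++-absent a N R (occ-old-in-new a≤M nN)))
  ... | suc _ = inj₁ (trans (cong newPart (before-++-present a X (N ++ R) (subst (0 <_) (sym e) z<s)))
                            (newPart-old (All-before a oX)))

  newPart-between-block : ∀ {a X N} → a ≤ M → Old X → New N → ∀ R →
    (newPart (between a (X ++ N ++ R)) ≡ []) ⊎
    (newPart (between a (X ++ N ++ R)) ≡ N ++ newPart (before a R)) ⊎
    (newPart (between a (X ++ N ++ R)) ≡ newPart (between a R))
  newPart-between-block {a} {X} {N} a≤M oX nN R with occ a X in e
  ... | zero = inj₂ (inj₂ (cong newPart (trans (between-++-absent a X (N ++ R) e)
                                               (between-++-absent a N R (occ-old-in-new a≤M nN)))))
  ... | suc zero =
    inj₂ (inj₁ (trans (cong newPart between≡) (newPart-old-new (All-after a oX) nN (before a R))))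
    where
    between≡ : between a (X ++ N ++ R) ≡ after a X ++ N ++ before a R
    between≡ = trans (between-++-once a X (N ++ R) e)
                     (cong (after a X ++_) (before-++-absent a N R (occ-old-in-new a≤M nN)))
  ... | suc (suc _) =
    inj₁ (trans (cong newPart (between-++-twice a X (N ++ R) (subst (2 ≤_) (sym e) (s≤s (s≤s z≤n)))))
                (newPart-old (All-between a oX)))

module Insertion (M : ℕ) (u : Word) (u-new : All (M <_) u) (u-noRep : NoRepeats u)
                 (m : ℕ) {{_ : NonZero m}} (m≡2∣u∣ : m ≡ length u + length u) where

  open NewSymbols M

  module TwoBlocks (v : Word) (v-new : New v) (v-noRep : NoRepeats v) (uv-doubles : doubles (u ++ v) ≡ m)
                   {y₁ y₂ y₃ : Word} (o₁ : Old y₁) (o₂ : Old y₂) (o₃ : Old y₃) where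

    W w : Word
    W = y₁ ++ u ++ y₂ ++ v ++ y₃
    w = y₁ ++ y₂ ++ y₃

    newPart-W : newPart W ≡ u ++ v
    newPart-W = begin
      newPart (y₁ ++ u ++ y₂ ++ v ++ y₃)   ≡⟨ newPart-old-new o₁ u-new (y₂ ++ v ++ y₃) ⟩
      u ++ newPart (y₂ ++ v ++ y₃)         ≡⟨ cong (u ++_) (newPart-old-new o₂ v-new y₃) ⟩
      u ++ v ++ newPart y₃                 ≡⟨ cong (λ T → u ++ v ++ T) (newPart-old o₃) ⟩
      u ++ v ++ []                         ≡⟨ cong (u ++_) (++-identityʳ v) ⟩
      u ++ v                               ∎
      where open ≡-Reasoning

    oldPart-W : oldPart W ≡ w
    oldPart-W = begin
      oldPart (y₁ ++ u ++ y₂ ++ v ++ y₃)   ≡⟨ oldPart-old-new o₁ u-new (y₂ ++ v ++ y₃) ⟩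
      y₁ ++ oldPart (y₂ ++ v ++ y₃)        ≡⟨ cong (y₁ ++_) (oldPart-old-new o₂ v-new y₃) ⟩
      y₁ ++ y₂ ++ oldPart y₃               ≡⟨ cong (λ T → y₁ ++ y₂ ++ T) (oldPart-old o₃) ⟩
      y₁ ++ y₂ ++ y₃                       ∎
      where open ≡-Reasoning

    -- The new letters enclosed by an old symbol form [], u, v or u ++ v.
    doubles-newPart-between : ∀ {a} → a ≤ M →
      (doubles (newPart (between a W)) ≡ 0) ⊎ (doubles (newPart (between a W)) ≡ m)
    doubles-newPart-between {a} a≤M with newPart-between-block a≤M o₁ u-new (y₂ ++ v ++ y₃)
    ... | inj₁ eq = inj₁ (cong doubles eq)
    ... | inj₂ (inj₁ eq) with newPart-before-block a≤M o₂ v-new y₃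
    ...   | inj₁ eq' = inj₁ (begin
            doubles (newPart (between a W))   ≡⟨ cong doubles (trans eq (cong (u ++_) eq')) ⟩
            doubles (u ++ [])                 ≡⟨ cong doubles (++-identityʳ u) ⟩
            doubles u                         ≡⟨ doubles-≡0 u u-noRep ⟩
            0                                 ∎)
      where open ≡-Reasoning
    ...   | inj₂ eq' = inj₂ (begin
            doubles (newPart (between a W))   ≡⟨ cong doubles (trans eq (cong (u ++_) eq')) ⟩
            doubles (u ++ v ++ newPart (before a y₃))
                                              ≡⟨ cong (λ T → doubles (u ++ v ++ T)) (newPart-old (All-before a o₃)) ⟩
            doubles (u ++ v ++ [])            ≡⟨ cong (λ T → doubles (u ++ T)) (++-identityʳ v) ⟩
            doubles (u ++ v)                  ≡⟨ uv-doubles ⟩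
            m                                 ∎)
      where open ≡-Reasoning
    doubles-newPart-between {a} a≤M | inj₂ (inj₂ eq) with newPart-between-block a≤M o₂ v-new y₃
    ...   | inj₁ eq' = inj₁ (cong doubles (trans eq eq'))
    ...   | inj₂ (inj₁ eq') = inj₁ (begin
            doubles (newPart (between a W))   ≡⟨ cong doubles (trans eq eq') ⟩
            doubles (v ++ newPart (before a y₃))
                                              ≡⟨ cong (λ T → doubles (v ++ T)) (newPart-old (All-before a o₃)) ⟩
            doubles (v ++ [])                 ≡⟨ cong doubles (++-identityʳ v) ⟩
            doubles v                         ≡⟨ doubles-≡0 v v-noRep ⟩
            0                                 ∎)
      where open ≡-Reasoning
    ...   | inj₂ (inj₂ eq') = inj₁ (cong doubles (trans eq (trans eq' (newPart-old (All-between a o₃)))))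

    enclosed-old-split : ∀ {a} → a ≤ M → enclosed a W ≡ doubles (newPart (between a W)) + enclosed a w
    enclosed-old-split {a} a≤M = trans (doubles-partition (M <?_) (between a W))
      (cong (doubles (newPart (between a W)) +_)
            (cong doubles (trans (filter-between (∁? (M <?_)) W (≤⇒≯ a≤M)) (cong (between a) oldPart-W))))

    enclosed-old : ∀ {a} → a ≤ M → enclosed a W % m ≡ enclosed a w % m
    enclosed-old {a} a≤M with doubles-newPart-between a≤M
    ... | inj₁ eq = cong (_% m) (trans (enclosed-old-split a≤M) (cong (_+ enclosed a w) eq))
    ... | inj₂ eq = begin
      enclosed a W % m                                  ≡⟨ cong (_% m) (enclosed-old-split a≤M) ⟩
      (doubles (newPart (between a W)) + enclosed a w) % m
                                                        ≡⟨ cong (λ n → (n + enclosed a w) % m) eq ⟩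
      (m + enclosed a w) % m                            ≡⟨ cong (_% m) (+-comm m (enclosed a w)) ⟩
      (enclosed a w + m) % m                            ≡⟨ [m+n]%n≡m%n (enclosed a w) m ⟩
      enclosed a w % m                                  ∎
      where open ≡-Reasoning

    residueCount-split : ∀ ρ → let hit = hasResidue m ρ W in
                         residueCount m ρ W ≡ count hit u + count hit v + residueCount m ρ w
    residueCount-split ρ = begin
      count hit W
        ≡⟨ count-partition hit (M <?_) W ⟩
      count hit (newPart W) + count hit (oldPart W)
        ≡⟨ cong₂ (λ S T → count hit S + count hit T) newPart-W oldPart-W ⟩
      count hit (u ++ v) + count hit w
        ≡⟨ cong₂ _+_ (count-++ hit u v) (count-cong (All.map agree old-w)) ⟩
      count hit u + count hit v + residueCount m ρ w ∎
      where
      open ≡-Reasoning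
      hit : ℕ → Bool
      hit = hasResidue m ρ W
      old-w : Old w
      old-w = ++⁺ o₁ (++⁺ o₂ o₃)
      agree : ∀ {a} → a ≤ M → hit a ≡ hasResidue m ρ w a
      agree a≤M = cong (λ n → does (n ≟ ρ)) (enclosed-old a≤M)

    between-first-block : ∀ {y} → y ∈ u → 0 < occ y v → between y W ≡ after y u ++ y₂ ++ before y v
    between-first-block {y} y∈u y∈v = begin
      between y (y₁ ++ u ++ y₂ ++ v ++ y₃)
        ≡⟨ between-++-absent y y₁ _ (occ-new-in-old M<y o₁) ⟩
      between y (u ++ y₂ ++ v ++ y₃)
        ≡⟨ between-++-once y u _ (occ-≡1 u u-noRep (∈⇒occ-pos y∈u)) ⟩
      after y u ++ before y (y₂ ++ v ++ y₃)
        ≡⟨ cong (after y u ++_) (before-++-absent y y₂ _ (occ-new-in-old M<y o₂)) ⟩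
      after y u ++ y₂ ++ before y (v ++ y₃)
        ≡⟨ cong (λ T → after y u ++ y₂ ++ T) (before-++-present y v y₃ y∈v) ⟩
      after y u ++ y₂ ++ before y v ∎
      where
      open ≡-Reasoning
      M<y : M < y
      M<y = All.lookup u-new y∈u

    enclosed-first-block : ∀ {y} → y ∈ u → 0 < occ y v →
                           enclosed y W ≡ doubles (after y u ++ before y v) + doubles y₂
    enclosed-first-block {y} y∈u y∈v = begin
      doubles (between y W)                       ≡⟨ cong doubles (between-first-block y∈u y∈v) ⟩
      doubles S                                   ≡⟨ doubles-partition (M <?_) S ⟩
      doubles (newPart S) + doubles (oldPart S)   ≡⟨ cong₂ (λ T T' → doubles T + doubles T') newPart-S oldPart-S ⟩
      doubles (A ++ B) + doubles y₂               ∎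
      where
      open ≡-Reasoning
      A B S : Word
      A = after y u
      B = before y v
      S = A ++ y₂ ++ B
      new-A : New A
      new-A = All-after y u-new
      new-B : New B
      new-B = All-before y v-new
      newPart-S : newPart S ≡ A ++ B
      newPart-S = trans (newPart-new-++ new-A (y₂ ++ B))
                        (cong (A ++_) (trans (newPart-old-++ o₂ B) (newPart-new new-B)))
      oldPart-S : oldPart S ≡ y₂
      oldPart-S = trans (oldPart-new-++ new-A (y₂ ++ B))
                        (trans (oldPart-old-++ o₂ B)
                               (trans (cong (y₂ ++_) (oldPart-new new-B)) (++-identityʳ y₂)))

  doubles-u++u : doubles (u ++ u) ≡ m
  doubles-u++u = trans (doubles-++-copy u u u-noRep (λ _ → refl)) (trans (length-++ u) (sym m≡2∣u∣))

  reverse-u-noRep : NoRepeats (reverse u)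
  reverse-u-noRep y = subst (_≤ 1) (sym (occ-reverse y u)) (u-noRep y)

  doubles-u++reverse-u : doubles (u ++ reverse u) ≡ m
  doubles-u++reverse-u = begin
    doubles (u ++ reverse u)       ≡⟨ doubles-++-copy u (reverse u) u-noRep (λ y → occ-reverse y u) ⟩
    length (u ++ reverse u)        ≡⟨ length-++ u ⟩
    length u + length (reverse u)  ≡⟨ cong (length u +_) (length-reverse u) ⟩
    length u + length u            ≡⟨ m≡2∣u∣ ⟨
    m                              ∎
    where open ≡-Reasoning

  module Repeat {y₁ y₂ y₃} (o₁ : Old y₁) (o₂ : Old y₂) (o₃ : Old y₃) where
    open TwoBlocks u u-new u-noRep doubles-u++u o₁ o₂ o₃ public

    enclosed-inserted : ∀ {y} → y ∈ u → enclosed y W ≡ doubles y₂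
    enclosed-inserted {y} y∈u =
      trans (enclosed-first-block y∈u (∈⇒occ-pos y∈u))
            (cong (_+ doubles y₂) (doubles-≡0 (after y u ++ before y u) noRep))
      where
      noRep : NoRepeats (after y u ++ before y u)
      noRep z = begin
        occ z (after y u ++ before y u)        ≡⟨ occ-++ z (after y u) (before y u) ⟩
        occ z (after y u) + occ z (before y u) ≡⟨ +-comm (occ z (after y u)) _ ⟩
        occ z (before y u) + occ z (after y u) ≤⟨ occ-before+occ-after≤occ z y u ⟩
        occ z u                                ≤⟨ u-noRep z ⟩
        1                                      ∎
        where open ≤-Reasoning

  module Return {y₁ y₂ y₃} (o₁ : Old y₁) (o₂ : Old y₂) (o₃ : Old y₃) where
    open TwoBlocks (reverse u) (All-reverse u-new) reverse-u-noRep doubles-u++reverse-u o₁ o₂ o₃ public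

    enclosed-inserted : ∀ {y} → y ∈ u →
                        enclosed y W ≡ doubles y₂ + (length (after y u) + length (after y u))
    enclosed-inserted {y} y∈u = begin
      enclosed y W                                      ≡⟨ enclosed-first-block y∈u y∈reverse-u ⟩
      doubles (A ++ before y (reverse u)) + doubles y₂  ≡⟨ cong (λ T → doubles (A ++ T) + doubles y₂)
                                                                before-reverse-u ⟩
      doubles (A ++ reverse A) + doubles y₂             ≡⟨ cong (_+ doubles y₂) doubles-mirror ⟩
      length (A ++ reverse A) + doubles y₂              ≡⟨ cong (_+ doubles y₂) length-mirror ⟩
      length A + length A + doubles y₂                  ≡⟨ +-comm (length A + length A) (doubles y₂) ⟩
      doubles y₂ + (length A + length A)                ∎
      where
      open ≡-Reasoning
      A : Word
      A = after y u
      y∈reverse-u : 0 < occ y (reverse u)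
      y∈reverse-u = subst (0 <_) (sym (occ-reverse y u)) (∈⇒occ-pos y∈u)
      before-reverse-u : before y (reverse u) ≡ reverse A
      before-reverse-u = before-reverse y u (occ-≡1 u u-noRep (∈⇒occ-pos y∈u))
      doubles-mirror : doubles (A ++ reverse A) ≡ length (A ++ reverse A)
      doubles-mirror = doubles-++-copy A (reverse A) (λ z → ≤-trans (occ-after≤occ z y u) (u-noRep z))
                                       (λ z → occ-reverse z A)
      length-mirror : length (A ++ reverse A) ≡ length A + length A
      length-mirror = trans (length-++ A) (cong (length A +_) (length-reverse A))

  repeat-return-residueCounts-differ :
    ∀ {y₁ y₂ y₃ z₁ z₂ z₃} → Old y₁ → Old y₂ → Old y₃ → Old z₁ → Old z₂ → Old z₃ →
    y₁ ++ y₂ ++ y₃ ≡ z₁ ++ z₂ ++ z₃ → 2 ≤ length u →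
    ¬ (∀ ρ → residueCount m ρ (y₁ ++ u ++ y₂ ++ u ++ y₃)
           ≡ residueCount m ρ (z₁ ++ u ++ z₂ ++ reverse u ++ z₃))
  repeat-return-residueCounts-differ {y₂ = y₂} {z₂ = z₂} o₁ o₂ o₃ p₁ p₂ p₃ same-w 2≤∣u∣ same-counts =
    4≰2 (begin
      2 + 2                        ≤⟨ +-mono-≤ 2≤∣u∣ 2≤∣u∣ ⟩
      length u + length u          ≡⟨ +-cancelʳ-≡ (residueCount m ρ Rep.w) _ _ counts ⟩
      count hit' u + count hit' u  ≤⟨ +-mono-≤ count-hit'-u count-hit'-u ⟩
      1 + 1                        ∎)
    where
    open ≤-Reasoning
    module Rep = Repeat o₁ o₂ o₃
    module Ret = Return p₁ p₂ p₃
    ρ : ℕ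
    ρ = doubles y₂ % m
    hit hit' : ℕ → Bool
    hit = hasResidue m ρ Rep.W
    hit' = hasResidue m ρ Ret.W

    4≰2 : ¬ (2 + 2 ≤ 1 + 1)
    4≰2 (s≤s (s≤s ()))

    count-hit-u : count hit u ≡ length u
    count-hit-u =
      count-all (All.tabulate (λ y∈u → dec-true (_ ≟ ρ) (cong (_% m) (Rep.enclosed-inserted y∈u))))

    offset-residue : ∀ {y} → y ∈ u → hit' y ≡ true →
                     (doubles z₂ + (length (after y u) + length (after y u))) % m ≡ ρ
    offset-residue y∈u hit'y =
      trans (cong (_% m) (sym (Ret.enclosed-inserted y∈u))) (does-true⇒ (_ ≟ ρ) hit'y)

    count-hit'-u : count hit' u ≤ 1
    count-hit'-u = count-≤1 hit' u u-noRep (λ y∈u y'∈u hit'y hit'y' →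
      length-after-injective u (∈⇒occ-pos y∈u) (∈⇒occ-pos y'∈u)
        (double-offset-%-injective (doubles z₂) m m≡2∣u∣
          (length-after< _ u (∈⇒occ-pos y∈u)) (length-after< _ u (∈⇒occ-pos y'∈u))
          (trans (offset-residue y∈u hit'y) (sym (offset-residue y'∈u hit'y')))))

    counts : length u + length u + residueCount m ρ Rep.w ≡ count hit' u + count hit' u + residueCount m ρ Rep.w
    counts = ≡.begin
      length u + length u + residueCount m ρ Rep.w
        ≡.≡⟨ cong (λ c → c + c + residueCount m ρ Rep.w) count-hit-u ⟨
      count hit u + count hit u + residueCount m ρ Rep.w
        ≡.≡⟨ Rep.residueCount-split ρ ⟨
      residueCount m ρ Rep.W
        ≡.≡⟨ same-counts ρ ⟩
      residueCount m ρ Ret.W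
        ≡.≡⟨ Ret.residueCount-split ρ ⟩
      count hit' u + count hit' (reverse u) + residueCount m ρ Ret.w
        ≡.≡⟨ cong₂ (λ c w → count hit' u + c + residueCount m ρ w) (count-reverse hit' u) (sym same-w) ⟩
      count hit' u + count hit' u + residueCount m ρ Rep.w ≡.∎
      where module ≡ = ≡-Reasoning

-- Insertions into a word

block-new : ∀ M ν → All (M <_) (block M ν)
block-new M zero = []
block-new M (suc ν) = ++⁺ (block-new M ν) (s≤s (m≤m+n M ν) ∷ [])

block-≤ : ∀ M ν → All (_≤ M + ν) (block M ν)
block-≤ M zero = []
block-≤ M (suc ν) = ++⁺ (All.map (λ y≤ → ≤-trans y≤ (+-monoʳ-≤ M (n≤1+n ν))) (block-≤ M ν))
                        (≤-reflexive (sym (+-suc M ν)) ∷ [])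

block-noRepeats : ∀ M ν → NoRepeats (block M ν)
block-noRepeats M zero y = z≤n
block-noRepeats M (suc ν) y rewrite occ-++ y (block M ν) [ suc (M + ν) ] with y ≟ suc (M + ν)
... | yes refl = ≤-reflexive (cong (_+ 1) (occ-∉ (block-≤ M ν) 1+n≰n))
... | no _ = ≤-trans (≤-reflexive (+-identityʳ _)) (block-noRepeats M ν y)

length-block : ∀ M ν → length (block M ν) ≡ ν
length-block M zero = refl
length-block M (suc ν) =
  trans (length-++ (block M ν)) (trans (cong (_+ 1) (length-block M ν)) (+-comm ν 1))

All-≤-maxSym : ∀ w → All (_≤ maxSym w) w
All-≤-maxSym [] = []
All-≤-maxSym (b ∷ w) =
  m≤m⊔n b (maxSym w) ∷ All.map (λ y≤ → ≤-trans y≤ (m≤n⊔m b (maxSym w))) (All-≤-maxSym w)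

take-drop-factorization : ∀ (w : Word) {i j} → i ≤ j → take i w ++ take (j ∸ i) (drop i w) ++ drop j w ≡ w
take-drop-factorization w {i} {j} i≤j = begin
  take i w ++ take (j ∸ i) (drop i w) ++ drop j w
    ≡⟨ cong (λ T → take i w ++ take (j ∸ i) (drop i w) ++ T) drop-j ⟩
  take i w ++ take (j ∸ i) (drop i w) ++ drop (j ∸ i) (drop i w)
    ≡⟨ cong (take i w ++_) (take++drop≡id (j ∸ i) (drop i w)) ⟩
  take i w ++ drop i w
    ≡⟨ take++drop≡id i w ⟩
  w ∎
  where
  open ≡-Reasoning
  drop-j : drop j w ≡ drop (j ∸ i) (drop i w)
  drop-j = trans (cong (λ n → drop n w) (sym (m+[n∸m]≡n i≤j))) (sym (drop-drop i (j ∸ i) w))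

∼⇒residueCount≡ : ∀ {x y} → x ∼ y → ∀ m .{{_ : NonZero m}} ρ →
                  residueCount m ρ x ≡ residueCount m ρ y
∼⇒residueCount≡ {x} (f , refl) m ρ = sym (residueCount-map m ρ x)
  where open Relabelling (Bijection.to f) (Bijection.injective f)

repeatIns-returnIns-residueCounts-differ : ∀ w n {k₁ ℓ₁ k₂ ℓ₂} → let ν = 2 + n in k₁ ≤ ℓ₁ → k₂ ≤ ℓ₂ →
  ¬ (∀ ρ → residueCount (ν + ν) ρ (insert repeatIns w ν k₁ ℓ₁)
         ≡ residueCount (ν + ν) ρ (insert returnIns w ν k₂ ℓ₂))
repeatIns-returnIns-residueCounts-differ w n {k₁} {ℓ₁} {k₂} {ℓ₂} k₁≤ℓ₁ k₂≤ℓ₂ =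
  repeat-return-residueCounts-differ
    (take⁺ (k₁ ∸ 1) old-w) (take⁺ _ (drop⁺ (k₁ ∸ 1) old-w)) (drop⁺ (ℓ₁ ∸ 1) old-w)
    (take⁺ (k₂ ∸ 1) old-w) (take⁺ _ (drop⁺ (k₂ ∸ 1) old-w)) (drop⁺ (ℓ₂ ∸ 1) old-w)
    (trans (take-drop-factorization w (∸-monoˡ-≤ 1 k₁≤ℓ₁))
           (sym (take-drop-factorization w (∸-monoˡ-≤ 1 k₂≤ℓ₂))))
    (subst (2 ≤_) (sym (length-block M ν)) (s≤s (s≤s z≤n)))
  where
  ν M : ℕ
  ν = 2 + n
  M = maxSym w
  old-w : All (_≤ M) w
  old-w = All-≤-maxSym w
  open Insertion M (block M ν) (block-new M ν) (block-noRepeats M ν)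
                 (ν + ν) (sym (cong₂ _+_ (length-block M ν) (length-block M ν)))

theorem3p17 : (w : Word) → DOW w → Ascending w →
    (ν : ℕ) → 2 ≤ ν →
    (κ₁ κ₂ : Kind) (k₁ ℓ₁ k₂ ℓ₂ : ℕ) →
    ValidPos w k₁ ℓ₁ → ValidPos w k₂ ℓ₂ →
    ¬ ((k₁ ≡ k₂) × (ℓ₁ ≡ ℓ₂)) →
    insert κ₁ w ν k₁ ℓ₁ ∼ insert κ₂ w ν k₂ ℓ₂ →
    κ₁ ≡ κ₂
theorem3p17 w _ _ ν _ repeatIns repeatIns _ _ _ _ _ _ _ _ = refl
theorem3p17 w _ _ ν _ returnIns returnIns _ _ _ _ _ _ _ _ = refl
theorem3p17 w _ _ (suc (suc n)) (s≤s (s≤s _)) repeatIns returnIns _ _ _ _ (_ , k₁≤ℓ₁ , _) (_ , k₂≤ℓ₂ , _) _ equiv =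
  ⊥-elim (repeatIns-returnIns-residueCounts-differ w n k₁≤ℓ₁ k₂≤ℓ₂ (∼⇒residueCount≡ equiv _))
theorem3p17 w _ _ (suc (suc n)) (s≤s (s≤s _)) returnIns repeatIns _ _ _ _ (_ , k₁≤ℓ₁ , _) (_ , k₂≤ℓ₂ , _) _ equiv =
  ⊥-elim (repeatIns-returnIns-residueCounts-differ w n k₂≤ℓ₂ k₁≤ℓ₁ (λ ρ → sym (∼⇒residueCount≡ equiv _ ρ)))
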